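{- Let $i\ge 0$ be an integer and $j,k,m$ real. Then: (a) $\sum_{r=0}^{i}c_{i,r,k}=c_{i,0,k-1}$; (b) $\sum_{r=0}^{i}c_{i,r,2}=(-1)^i\, i!$; (c) $\sum_{r=0}^{i}c_{i,r,k}(j+k)^r=(j)_i$; (d) $\sum_{r=0}^{i}c_{i,r,k}(i+k)^r=i!$; (e) for $i>0$: $\sum_{r=0}^{i}c_{i,r,k}\,m^r=0$ if and only if $m\in\{k,k+1,\ldots,k+i-1\}$; (f) for $i>0$: $\sum_{r=0}^{i}c_{i,r,k}=0$ if and only if $k\in\{1,0,-1,\ldots,-i+2\}$; (g) $c_{i,0,2}=(-1)^i\,(i+1)!$.
   Context: $(x)_i=x(x-1)\cdots(x-i+1)$ is the falling factorial ($(x)_0=1$). The signed Stirling numbers of the first kind $s_{i,r}$ are defined by $(x)_i=\sum_{r=0}^{i}s_{i,r}x^r$. For integers $i,j\ge0$ and real $k$, $c_{i,j,k}=\sum_{r=j}^{i}\binom{r}{j}(-k)^{r-j}s_{i,r}$ (zero if $j>i$); $0^0=1$. -}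

module Defs where

open import Level using (Level)
open import Data.Nat as ℕ using (ℕ; zero; suc; _∸_)
open import Data.Nat.Combinatorics using (_C_)
open import Data.Integer as ℤ using (ℤ; +_; -[1+_])
open import Algebra.Bundles using (CommutativeRing)

-- Signed Stirling numbers of the first kind, s i r, as the coefficients of
-- x^r in (x)_i = (x)_{i-1} * (x - (i-1)), i.e. via the coefficient recurrence
-- obtained by multiplying the coefficient list of (x)_{i-1} by (x - (i-1)).
stirling1 : ℕ → ℕ → ℤ
stirling1 zero    zero    = + 1
stirling1 zero    (suc r) = + 0
stirling1 (suc i) zero    = ℤ.- ((+ i) ℤ.* stirling1 i zero)
stirling1 (suc i) (suc r) = stirling1 i r ℤ.- ((+ i) ℤ.* stirling1 i (suc r))

module RingDefs {c ℓ : Level} (R : CommutativeRing c ℓ) where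
  open CommutativeRing R

  natR : ℕ → Carrier
  natR zero    = 0#
  natR (suc n) = 1# + natR n

  intR : ℤ → Carrier
  intR (+ n)     = natR n
  intR -[1+ n ]  = - natR (suc n)

  -- powers, with x ^ 0 = 1 (so 0 ^ 0 = 1)
  pow : Carrier → ℕ → Carrier
  pow x zero    = 1#
  pow x (suc n) = pow x n * x

  falling : Carrier → ℕ → Carrier
  falling x zero    = 1#
  falling x (suc i) = falling x i * (x - natR i)

  sumTo : ℕ → (ℕ → Carrier) → Carrier
  sumTo zero    f = 0#
  sumTo (suc n) f = sumTo n f + f n

  -- sumRange a b f = Σ_{r=a}^{b} f r  (empty, i.e. 0, if a > b)
  sumRange : ℕ → ℕ → (ℕ → Carrier) → Carrier
  sumRange a b f = sumTo (suc b ∸ a) (λ t → f (a ℕ.+ t))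

  -- c_{i,j,k} = Σ_{r=j}^{i} binom(r,j) (-k)^{r-j} s_{i,r}   (0 if j > i)
  cc : ℕ → ℕ → Carrier → Carrier
  cc i j k = sumRange j i (λ r → natR (r C j) * pow (- k) (r ∸ j) * intR (stirling1 i r))

-- The c_{i,j,k} are the coefficients of the translated Stirling polynomial:
-- by the binomial theorem, Σ_j c_{i,j,k} x^j = Σ_r s_{i,r} (x - k)^r, and the
-- s_{i,r} are the coefficients of (x)_i, so Σ_j c_{i,j,k} x^j = (x - k)_i.
-- Every part is then a value of a falling factorial: at x = 1 for the sums,
-- at x = j + k and x = i + k, and c_{i,0,k} = (-k)_i, with
-- (-1)_i = (-1)^i i! and (-2)_i = (-1)^i (i+1)!.  The zero sets come from
-- (y)_i = 0 iff y ∈ {0, …, i-1}, which holds in any integral domain.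

module Submission where

open import Defs
open import Level using (Level)
open import Data.Nat as ℕ using (ℕ; _<_; _!)
open import Data.Product using (_×_; ∃-syntax)
open import Data.Sum using (_⊎_)
open import Relation.Nullary using (¬_)
open import Function.Bundles using (_⇔_)
open import Algebra.Bundles using (CommutativeRing)

open import Data.Nat using (zero; suc; _≤_; _∸_)
import Data.Nat.Properties as ℕ
open import Data.Nat.Combinatorics using (_C_)
open import Data.Integer as ℤ using (ℤ; +_; -[1+_])
import Data.Integer.Properties as ℤ
open import Data.Maybe using (Maybe; just; nothing)
open import Data.Product using (_,_; map₂)
open import Data.Sum using (inj₁; inj₂)
open import Data.Empty using (⊥-elim)
import Data.Fin as Fin
open import Function.Bundles using (mk⇔; Equivalence)
import Function.Properties.Equivalence as ⇔
open import Relation.Nullary using (yes; no)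
open import Relation.Binary.PropositionalEquality as ≡ using (_≡_)
import Algebra.Solver.Ring.AlmostCommutativeRing as ACR
import Algebra.Solver.Ring as RingSolver

∃<-cong : ∀ {a b} {A : ℕ → Set a} {B : ℕ → Set b} {i} →
  (∀ t → A t ⇔ B t) → (∃[ t ] (t < i × A t)) ⇔ (∃[ t ] (t < i × B t))
∃<-cong A⇔B =
  mk⇔ (map₂ (map₂ (Equivalence.to (A⇔B _)))) (map₂ (map₂ (Equivalence.from (A⇔B _))))

module Properties {c ℓ : Level} (R : CommutativeRing c ℓ) where
  open CommutativeRing R
  open RingDefs R
  open import Algebra.Properties.AbelianGroup +-abelianGroup
    using (ε⁻¹≈ε; ⁻¹-involutive; ⁻¹-∙-comm; x∙y⁻¹≈ε⇒x≈y)
  open import Algebra.Properties.CommutativeSemigroup +-commutativeSemigroup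
    using (interchange)
  open import Algebra.Properties.Ring ring using (-‿distribˡ-*; -‿distribʳ-*)
  import Algebra.Properties.Semiring.Mult semiring as Mult
  open import Algebra.Properties.Semiring.Exp semiring using (_^_)
  open import Algebra.Properties.Semiring.Sum semiring using (sum)
  import Algebra.Properties.CommutativeSemiring.Binomial commutativeSemiring as Binomial
  open import Relation.Binary.Reasoning.Setoid setoid

  natR≡×1# : ∀ n → natR n ≡ n Mult.× 1#
  natR≡×1# zero    = ≡.refl
  natR≡×1# (suc n) = ≡.cong (λ x → 1# + x) (natR≡×1# n)

  natR-homo-+ : ∀ m n → natR (m ℕ.+ n) ≈ natR m + natR n
  natR-homo-+ m n rewrite natR≡×1# (m ℕ.+ n) | natR≡×1# m | natR≡×1# n = Mult.×-homo-+ 1# m n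

  natR-homo-* : ∀ m n → natR (m ℕ.* n) ≈ natR m * natR n
  natR-homo-* m n rewrite natR≡×1# (m ℕ.* n) | natR≡×1# m | natR≡×1# n = Mult.×1-homo-* m n

  intR-homo-neg : ∀ z → intR (ℤ.- z) ≈ - intR z
  intR-homo-neg -[1+ n ]     = sym (⁻¹-involutive _)
  intR-homo-neg (+ zero)     = sym ε⁻¹≈ε
  intR-homo-neg (+ (suc n))  = refl

  [1+x]-[1+y]≈x-y : ∀ x y → (1# + x) - (1# + y) ≈ x - y
  [1+x]-[1+y]≈x-y x y = begin
    (1# + x) - (1# + y)      ≈⟨ +-congˡ (⁻¹-∙-comm 1# y) ⟨
    (1# + x) + (- 1# + - y)  ≈⟨ interchange 1# x (- 1#) (- y) ⟩
    (1# - 1#) + (x - y)      ≈⟨ +-congʳ (-‿inverseʳ 1#) ⟩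
    0# + (x - y)             ≈⟨ +-identityˡ _ ⟩
    x - y                    ∎

  intR-⊖ : ∀ m n → intR (m ℤ.⊖ n) ≈ natR m - natR n
  intR-⊖ m       zero    = sym (trans (+-congˡ ε⁻¹≈ε) (+-identityʳ _))
  intR-⊖ zero    (suc n) = sym (+-identityˡ _)
  intR-⊖ (suc m) (suc n) = begin
    intR (suc m ℤ.⊖ suc n)     ≡⟨ ≡.cong intR (ℤ.[1+m]⊖[1+n]≡m⊖n m n) ⟩
    intR (m ℤ.⊖ n)             ≈⟨ intR-⊖ m n ⟩
    natR m - natR n            ≈⟨ [1+x]-[1+y]≈x-y (natR m) (natR n) ⟨
    natR (suc m) - natR (suc n) ∎

  intR-homo-+ : ∀ a b → intR (a ℤ.+ b) ≈ intR a + intR b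
  intR-homo-+ (+ m)    (+ n)    = natR-homo-+ m n
  intR-homo-+ (+ m)    -[1+ n ] = intR-⊖ m (suc n)
  intR-homo-+ -[1+ m ] (+ n)    = trans (intR-⊖ n (suc m)) (+-comm _ _)
  intR-homo-+ -[1+ m ] -[1+ n ] = begin
    - natR (suc (suc (m ℕ.+ n)))         ≡⟨ ≡.cong (λ l → - natR (suc l)) (ℕ.+-suc m n) ⟨
    - natR (suc m ℕ.+ suc n)             ≈⟨ -‿cong (natR-homo-+ (suc m) (suc n)) ⟩
    - (natR (suc m) + natR (suc n))      ≈⟨ ⁻¹-∙-comm _ _ ⟨
    - natR (suc m) + - natR (suc n)      ∎

  intR-homo-*ˡ-+ : ∀ m b → intR (+ m ℤ.* b) ≈ natR m * intR b
  intR-homo-*ˡ-+ m (+ n)    = trans (≡.subst (λ z → intR z ≈ natR (m ℕ.* n)) (ℤ.pos-* m n) refl)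
                                    (natR-homo-* m n)
  intR-homo-*ˡ-+ m -[1+ n ] = begin
    intR (+ m ℤ.* ℤ.- + suc n)     ≡⟨ ≡.cong intR (ℤ.neg-distribʳ-* (+ m) (+ suc n)) ⟨
    intR (ℤ.- (+ m ℤ.* + suc n))   ≈⟨ intR-homo-neg (+ m ℤ.* + suc n) ⟩
    - intR (+ m ℤ.* + suc n)       ≈⟨ -‿cong (intR-homo-*ˡ-+ m (+ suc n)) ⟩
    - (natR m * natR (suc n))      ≈⟨ -‿distribʳ-* _ _ ⟩
    natR m * - natR (suc n)        ∎

  intR-homo-* : ∀ a b → intR (a ℤ.* b) ≈ intR a * intR b
  intR-homo-* (+ m)    b = intR-homo-*ˡ-+ m b
  intR-homo-* -[1+ m ] b = begin
    intR (ℤ.- + suc m ℤ.* b)       ≡⟨ ≡.cong intR (ℤ.neg-distribˡ-* (+ suc m) b) ⟨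
    intR (ℤ.- (+ suc m ℤ.* b))     ≈⟨ intR-homo-neg (+ suc m ℤ.* b) ⟩
    - intR (+ suc m ℤ.* b)         ≈⟨ -‿cong (intR-homo-*ˡ-+ (suc m) b) ⟩
    - (natR (suc m) * intR b)      ≈⟨ -‿distribˡ-* _ _ ⟩
    - natR (suc m) * intR b        ∎

  -- Agrees with intR, but sends + 0 and + 1 to 0# and 1# on the nose, so
  -- that the solver's constants are literally the ring's 0# and 1#.
  coefficient : ℤ → Carrier
  coefficient (+ 0) = 0#
  coefficient (+ 1) = 1#
  coefficient z     = intR z

  coefficient≈intR : ∀ z → coefficient z ≈ intR z
  coefficient≈intR (+ 0)           = refl
  coefficient≈intR (+ 1)           = sym (+-identityʳ 1#)
  coefficient≈intR (+ suc (suc n)) = refl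
  coefficient≈intR -[1+ n ]        = refl

  ℤ⟶R : CommutativeRing.rawRing ℤ.+-*-commutativeRing
          ACR.-Raw-AlmostCommutative⟶ ACR.fromCommutativeRing R
  ℤ⟶R = record
    { ⟦_⟧    = coefficient
    ; +-homo = λ a b → transport (intR-homo-+ a b) (coefficient≈intR (a ℤ.+ b))
                         (+-cong (coefficient≈intR a) (coefficient≈intR b))
    ; *-homo = λ a b → transport (intR-homo-* a b) (coefficient≈intR (a ℤ.* b))
                         (*-cong (coefficient≈intR a) (coefficient≈intR b))
    ; -‿homo = λ a → transport (intR-homo-neg a) (coefficient≈intR (ℤ.- a))
                       (-‿cong (coefficient≈intR a))
    ; 0-homo = refl
    ; 1-homo = refl
    }
    where
    transport : ∀ {x y x′ y′} → x ≈ y → x′ ≈ x → y′ ≈ y → x′ ≈ y′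
    transport x≈y x′≈x y′≈y = trans x′≈x (trans x≈y (sym y′≈y))

  coefficient-≟ : ∀ a b → Maybe (coefficient a ≈ coefficient b)
  coefficient-≟ a b with a ℤ.≟ b
  ... | yes a≡b = just (reflexive (≡.cong coefficient a≡b))
  ... | no  _   = nothing

  open RingSolver (CommutativeRing.rawRing ℤ.+-*-commutativeRing)
    (ACR.fromCommutativeRing R) ℤ⟶R coefficient-≟
    using (solve; _:+_; _:*_; _:-_; :-_; _:=_; con)

  x-y≈z⇔x≈y+z : ∀ x y z → x - y ≈ z ⇔ x ≈ y + z
  x-y≈z⇔x≈y+z x y z = mk⇔
    (λ x-y≈z → trans (solve 2 (λ x y → x := y :+ (x :- y)) refl x y) (+-congˡ x-y≈z))
    (λ x≈y+z → trans (+-congʳ x≈y+z) (solve 2 (λ y z → y :+ z :- y := z) refl y z))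

  x-y≈z⇔y≈x-z : ∀ x y z → x - y ≈ z ⇔ y ≈ x - z
  x-y≈z⇔y≈x-z x y z = mk⇔
    (λ x-y≈z → trans (solve 2 (λ x y → y := x :- (x :- y)) refl x y) (+-congˡ (-‿cong x-y≈z)))
    (λ y≈x-z → trans (+-congˡ (-‿cong y≈x-z)) (solve 2 (λ x z → x :- (x :- z) := z) refl x z))

  ≈0-cong : ∀ {x y} → x ≈ y → x ≈ 0# ⇔ y ≈ 0#
  ≈0-cong x≈y = mk⇔ (trans (sym x≈y)) (trans x≈y)

  pow-one : ∀ n → pow 1# n ≈ 1#
  pow-one zero    = refl
  pow-one (suc n) = trans (*-identityʳ _) (pow-one n)

  sumTo-cong : ∀ n {f g} → (∀ j → j < n → f j ≈ g j) → sumTo n f ≈ sumTo n g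
  sumTo-cong zero    f≈g = refl
  sumTo-cong (suc n) f≈g = +-cong (sumTo-cong n (λ j j<n → f≈g j (ℕ.m<n⇒m<1+n j<n)))
                                  (f≈g n (ℕ.n<1+n n))

  sumTo-distrib-+ : ∀ n f g → sumTo n (λ j → f j + g j) ≈ sumTo n f + sumTo n g
  sumTo-distrib-+ zero    f g = sym (+-identityʳ 0#)
  sumTo-distrib-+ (suc n) f g = trans (+-congʳ (sumTo-distrib-+ n f g)) (interchange _ _ _ _)

  sumTo-distribˡ : ∀ n x f → sumTo n (λ j → x * f j) ≈ x * sumTo n f
  sumTo-distribˡ zero    x f = sym (zeroʳ x)
  sumTo-distribˡ (suc n) x f = trans (+-congʳ (sumTo-distribˡ n x f)) (sym (distribˡ _ _ _))

  sumTo-sucˡ : ∀ n f → sumTo (suc n) f ≈ f 0 + sumTo n (λ j → f (suc j))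
  sumTo-sucˡ zero    f = +-comm _ _
  sumTo-sucˡ (suc n) f = trans (+-congʳ (sumTo-sucˡ n f)) (+-assoc _ _ _)

  sum≈sumTo : ∀ n (f : ℕ → Carrier) → sum {n} (λ j → f (Fin.toℕ j)) ≈ sumTo n f
  sum≈sumTo zero    f = refl
  sum≈sumTo (suc n) f = trans (+-congˡ (sum≈sumTo n (λ j → f (suc j)))) (sym (sumTo-sucˡ n f))

  sumRange-sucʳ : ∀ {a b} f → a ≤ suc b → sumRange a (suc b) f ≈ sumRange a b f + f (suc b)
  sumRange-sucʳ {a} {b} f a≤1+b rewrite ℕ.+-∸-assoc 1 a≤1+b =
    +-congˡ (reflexive (≡.cong f (ℕ.m+[n∸m]≡n a≤1+b)))

  sumRange-empty : ∀ b f → sumRange (suc b) b f ≈ 0#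
  sumRange-empty b f rewrite ℕ.n∸n≡0 b = refl

  ×≈natR* : ∀ m x → m Mult.× x ≈ natR m * x
  ×≈natR* m x rewrite natR≡×1# m =
    trans (Mult.×-congʳ m (sym (*-identityˡ x))) (sym (Mult.×-assoc-* m 1# x))

  pow≈^ : ∀ x n → pow x n ≈ x ^ n
  pow≈^ x zero    = refl
  pow≈^ x (suc n) = trans (*-comm _ _) (*-congˡ (pow≈^ x n))

  binomial : ∀ n x y → sumTo (suc n) (λ j → natR (n C j) * pow y (n ∸ j) * pow x j) ≈ pow (x + y) n
  binomial n x y = sym (begin
    pow (x + y) n
      ≈⟨ pow≈^ (x + y) n ⟩
    (x + y) ^ n
      ≈⟨ Binomial.theorem n x y ⟩
    sum {suc n} (λ j → (n C Fin.toℕ j) Mult.× (x ^ Fin.toℕ j * y ^ (n ∸ Fin.toℕ j)))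
      ≈⟨ sum≈sumTo (suc n) (λ j → (n C j) Mult.× (x ^ j * y ^ (n ∸ j))) ⟩
    sumTo (suc n) (λ j → (n C j) Mult.× (x ^ j * y ^ (n ∸ j)))
      ≈⟨ sumTo-cong (suc n) (λ j _ → term≈ j) ⟩
    sumTo (suc n) (λ j → natR (n C j) * pow y (n ∸ j) * pow x j) ∎)
    where
    term≈ : ∀ j → (n C j) Mult.× (x ^ j * y ^ (n ∸ j)) ≈ natR (n C j) * pow y (n ∸ j) * pow x j
    term≈ j = begin
      (n C j) Mult.× (x ^ j * y ^ (n ∸ j))       ≈⟨ Mult.×-congʳ (n C j) (*-comm _ _) ⟩
      (n C j) Mult.× (y ^ (n ∸ j) * x ^ j)       ≈⟨ Mult.×-assoc-* (n C j) _ _ ⟨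
      ((n C j) Mult.× (y ^ (n ∸ j))) * x ^ j     ≈⟨ *-congʳ (×≈natR* (n C j) _) ⟩
      natR (n C j) * y ^ (n ∸ j) * x ^ j         ≈⟨ *-cong (*-congˡ (pow≈^ y (n ∸ j))) (pow≈^ x j) ⟨
      natR (n C j) * pow y (n ∸ j) * pow x j     ∎

  translateCoeff : (ℕ → Carrier) → Carrier → ℕ → ℕ → Carrier
  translateCoeff a k n j = sumRange j n (λ r → natR (r C j) * pow (- k) (r ∸ j) * a r)

  translateCoeff-suc : ∀ a k n j → j ≤ suc n →
    translateCoeff a k (suc n) j
      ≈ translateCoeff a k n j + natR (suc n C j) * pow (- k) (suc n ∸ j) * a (suc n)
  translateCoeff-suc a k n j = sumRange-sucʳ (λ r → natR (r C j) * pow (- k) (r ∸ j) * a r)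

  translateCoeff-above : ∀ a k n → translateCoeff a k n (suc n) ≈ 0#
  translateCoeff-above a k n = sumRange-empty n (λ r → natR (r C suc n) * pow (- k) (r ∸ suc n) * a r)

  translateCoeff-polynomial : ∀ a k x n →
    sumTo (suc n) (λ j → translateCoeff a k n j * pow x j) ≈ sumTo (suc n) (λ r → a r * pow (x - k) r)
  translateCoeff-polynomial a k x zero =
    solve 1 (λ a → con (+ 0) :+ (con (+ 0) :+ (con (+ 1) :+ con (+ 0)) :* con (+ 1) :* a) :* con (+ 1)
                   := con (+ 0) :+ a :* con (+ 1)) refl (a 0)
  translateCoeff-polynomial a k x (suc n) = begin
    sumTo (suc (suc n)) (λ j → translateCoeff a k (suc n) j * pow x j)
      ≈⟨ sumTo-cong (suc (suc n)) (λ j j<n+2 → split j (ℕ.m<1+n⇒m≤n j<n+2)) ⟩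
    sumTo (suc (suc n)) (λ j → translateCoeff a k n j * pow x j + a (suc n) * binomialTerm j)
      ≈⟨ sumTo-distrib-+ (suc (suc n)) _ _ ⟩
    sumTo (suc n) (λ j → translateCoeff a k n j * pow x j) + translateCoeff a k n (suc n) * pow x (suc n)
      + sumTo (suc (suc n)) (λ j → a (suc n) * binomialTerm j)
      ≈⟨ +-cong (+-congˡ (trans (*-congʳ (translateCoeff-above a k n)) (zeroˡ _)))
                (sumTo-distribˡ (suc (suc n)) (a (suc n)) binomialTerm) ⟩
    sumTo (suc n) (λ j → translateCoeff a k n j * pow x j) + 0#
      + a (suc n) * sumTo (suc (suc n)) binomialTerm
      ≈⟨ +-cong (trans (+-identityʳ _) (translateCoeff-polynomial a k x n))
                (*-congˡ (binomial (suc n) x (- k))) ⟩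
    sumTo (suc n) (λ r → a r * pow (x - k) r) + a (suc n) * pow (x - k) (suc n) ∎
    where
    binomialTerm : ℕ → Carrier
    binomialTerm j = natR (suc n C j) * pow (- k) (suc n ∸ j) * pow x j

    split : ∀ j → j ≤ suc n →
      translateCoeff a k (suc n) j * pow x j ≈ translateCoeff a k n j * pow x j + a (suc n) * binomialTerm j
    split j j≤n+1 = trans (*-congʳ (translateCoeff-suc a k n j j≤n+1))
      (solve 5 (λ t b q a y → (t :+ b :* q :* a) :* y := t :* y :+ a :* (b :* q :* y)) refl
         (translateCoeff a k n j) (natR (suc n C j)) (pow (- k) (suc n ∸ j)) (a (suc n)) (pow x j))

  stirling1-above : ∀ i r → i < r → stirling1 i r ≡ + 0
  stirling1-above zero    (suc r) _ = ≡.refl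
  stirling1-above (suc i) (suc r) (ℕ.s≤s i<r)
    rewrite stirling1-above i r i<r | stirling1-above i (suc r) (ℕ.m<n⇒m<1+n i<r)
          | ℤ.*-zeroʳ (+ i) = ≡.refl

  intR-stirling1-suc-zero : ∀ i → intR (stirling1 (suc i) 0) ≈ - (natR i * intR (stirling1 i 0))
  intR-stirling1-suc-zero i =
    trans (intR-homo-neg (+ i ℤ.* stirling1 i 0)) (-‿cong (intR-homo-* (+ i) (stirling1 i 0)))

  intR-stirling1-suc-suc : ∀ i r →
    intR (stirling1 (suc i) (suc r)) ≈ intR (stirling1 i r) - natR i * intR (stirling1 i (suc r))
  intR-stirling1-suc-suc i r = begin
    intR (stirling1 i r ℤ.- + i ℤ.* stirling1 i (suc r))
      ≈⟨ intR-homo-+ (stirling1 i r) (ℤ.- (+ i ℤ.* stirling1 i (suc r))) ⟩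
    intR (stirling1 i r) + intR (ℤ.- (+ i ℤ.* stirling1 i (suc r)))
      ≈⟨ +-congˡ (intR-homo-neg (+ i ℤ.* stirling1 i (suc r))) ⟩
    intR (stirling1 i r) - intR (+ i ℤ.* stirling1 i (suc r))
      ≈⟨ +-congˡ (-‿cong (intR-homo-* (+ i) (stirling1 i (suc r)))) ⟩
    intR (stirling1 i r) - natR i * intR (stirling1 i (suc r)) ∎

  stirling1-generating : ∀ i y → sumTo (suc i) (λ r → intR (stirling1 i r) * pow y r) ≈ falling y i
  stirling1-generating zero    y =
    solve 0 (con (+ 0) :+ (con (+ 1) :+ con (+ 0)) :* con (+ 1) := con (+ 1)) refl
  stirling1-generating (suc i) y = begin
    S (suc i) (suc (suc i))                                 ≈⟨ S-suc i (suc i) ⟩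
    S i (suc i) * y - natR i * S i (suc (suc i))            ≡⟨⟩
    S i (suc i) * y - natR i * (S i (suc i) + intR (stirling1 i (suc i)) * pow y (suc i))
      ≈⟨ +-congˡ (-‿cong (*-congˡ (+-congˡ (*-congʳ (reflexive top≡0))))) ⟩
    S i (suc i) * y - natR i * (S i (suc i) + 0# * pow y (suc i))
      ≈⟨ solve 4 (λ s n p y → s :* y :- n :* (s :+ con (+ 0) :* p) := s :* (y :- n)) refl
           (S i (suc i)) (natR i) (pow y (suc i)) y ⟩
    S i (suc i) * (y - natR i)                              ≈⟨ *-congʳ (stirling1-generating i y) ⟩
    falling y i * (y - natR i)                              ∎
    where
    S : ℕ → ℕ → Carrier
    S l n = sumTo n (λ r → intR (stirling1 l r) * pow y r)

    top≡0 : intR (stirling1 i (suc i)) ≡ 0#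
    top≡0 = ≡.cong intR (stirling1-above i (suc i) (ℕ.n<1+n i))

    S-suc : ∀ l n → S (suc l) (suc n) ≈ S l n * y - natR l * S l (suc n)
    S-suc l zero = trans (+-congˡ (*-congʳ (intR-stirling1-suc-zero l)))
      (solve 3 (λ n s y → con (+ 0) :+ (:- (n :* s)) :* con (+ 1)
                          := con (+ 0) :* y :- n :* (con (+ 0) :+ s :* con (+ 1))) refl
         (natR l) (intR (stirling1 l 0)) y)
    S-suc l (suc n) = trans (+-cong (S-suc l n) (*-congʳ (intR-stirling1-suc-suc l n)))
      (solve 7 (λ A B s s′ m p y → (A :* y :- m :* B) :+ (s :- m :* s′) :* (p :* y)
                                   := (A :+ s :* p) :* y :- m :* (B :+ s′ :* (p :* y))) refl
         (S l n) (S l (suc n)) (intR (stirling1 l n)) (intR (stirling1 l (suc n))) (natR l) (pow y n) y)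

  rising : Carrier → ℕ → Carrier
  rising x zero    = 1#
  rising x (suc i) = rising x i * (x + natR i)

  falling-cong : ∀ i {x y} → x ≈ y → falling x i ≈ falling y i
  falling-cong zero    x≈y = refl
  falling-cong (suc i) x≈y = *-cong (falling-cong i x≈y) (+-congʳ x≈y)

  falling-sucˡ : ∀ x i → falling x (suc i) ≈ x * falling (x - 1#) i
  falling-sucˡ x zero    = solve 1 (λ x → con (+ 1) :* (x :- con (+ 0)) := x :* con (+ 1)) refl x
  falling-sucˡ x (suc i) = trans (*-congʳ (falling-sucˡ x i))
    (solve 3 (λ x f n → x :* f :* (x :- (con (+ 1) :+ n)) := x :* (f :* (x :- con (+ 1) :- n))) refl
       x (falling (x - 1#) i) (natR i))

  falling-natR : ∀ n → falling (natR n) n ≈ natR (n !)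
  falling-natR zero    = sym (+-identityʳ 1#)
  falling-natR (suc n) = begin
    falling (natR (suc n)) (suc n)          ≈⟨ falling-sucˡ (natR (suc n)) n ⟩
    natR (suc n) * falling (1# + natR n - 1#) n
      ≈⟨ *-congˡ (falling-cong n (solve 1 (λ n → con (+ 1) :+ n :- con (+ 1) := n) refl (natR n))) ⟩
    natR (suc n) * falling (natR n) n       ≈⟨ *-congˡ (falling-natR n) ⟩
    natR (suc n) * natR (n !)               ≈⟨ natR-homo-* (suc n) (n !) ⟨
    natR (suc n !)                          ∎

  falling-neg : ∀ x i → falling (- x) i ≈ pow (- 1#) i * rising x i
  falling-neg x zero    = solve 0 (con (+ 1) := con (+ 1) :* con (+ 1)) refl
  falling-neg x (suc i) = trans (*-congʳ (falling-neg x i))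
    (solve 4 (λ p r x n → p :* r :* (:- x :- n) := p :* (:- con (+ 1)) :* (r :* (x :+ n))) refl
       (pow (- 1#) i) (rising x i) x (natR i))

  rising-sucˡ : ∀ x i → rising x (suc i) ≈ x * rising (x + 1#) i
  rising-sucˡ x zero    = solve 1 (λ x → con (+ 1) :* (x :+ con (+ 0)) := x :* con (+ 1)) refl x
  rising-sucˡ x (suc i) = trans (*-congʳ (rising-sucˡ x i))
    (solve 3 (λ x r n → x :* r :* (x :+ (con (+ 1) :+ n)) := x :* (r :* (x :+ con (+ 1) :+ n))) refl
       x (rising (x + 1#) i) (natR i))

  rising-one : ∀ i → rising 1# i ≈ natR (i !)
  rising-one zero    = sym (+-identityʳ 1#)
  rising-one (suc i) = begin
    rising 1# i * (1# + natR i)   ≈⟨ *-congʳ (rising-one i) ⟩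
    natR (i !) * natR (suc i)     ≈⟨ *-comm _ _ ⟩
    natR (suc i) * natR (i !)     ≈⟨ natR-homo-* (suc i) (i !) ⟨
    natR (suc i !)                ∎

  rising-two : ∀ i → rising (1# + 1#) i ≈ natR (suc i !)
  rising-two i = begin
    rising (1# + 1#) i         ≈⟨ *-identityˡ _ ⟨
    1# * rising (1# + 1#) i    ≈⟨ rising-sucˡ 1# i ⟨
    rising 1# (suc i)          ≈⟨ rising-one (suc i) ⟩
    natR (suc i !)             ∎

  falling≈0-at-natR : ∀ i y t → t < i → y ≈ natR t → falling y i ≈ 0#
  falling≈0-at-natR (suc i) y t t<1+i y≈t with ℕ.m<1+n⇒m<n∨m≡n t<1+i
  ... | inj₁ t<i    = trans (*-congʳ (falling≈0-at-natR i y t t<i y≈t)) (zeroˡ _)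
  ... | inj₂ ≡.refl = trans (*-congˡ (trans (+-congʳ y≈t) (-‿inverseʳ _))) (zeroʳ _)

  -- cc i is translateCoeff of the Stirling numbers of order i on the nose.
  cc-polynomial : ∀ i k x → sumTo (suc i) (λ r → cc i r k * pow x r) ≈ falling (x - k) i
  cc-polynomial i k x =
    trans (translateCoeff-polynomial (λ r → intR (stirling1 i r)) k x i) (stirling1-generating i (x - k))

  cc-sum : ∀ i k → sumTo (suc i) (λ r → cc i r k) ≈ falling (1# - k) i
  cc-sum i k = trans (sumTo-cong (suc i) (λ r _ → sym (trans (*-congˡ (pow-one r)) (*-identityʳ _))))
                     (cc-polynomial i k 1#)

  cc-zero : ∀ i k → cc i 0 k ≈ falling (- k) i
  cc-zero i k = trans (sumTo-cong (suc i) (λ r _ → term≈ r)) (stirling1-generating i (- k))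
    where
    term≈ : ∀ r → natR (r C 0) * pow (- k) r * intR (stirling1 i r) ≈ intR (stirling1 i r) * pow (- k) r
    term≈ r = solve 2 (λ p s → (con (+ 1) :+ con (+ 0)) :* p :* s := s :* p) refl
                (pow (- k) r) (intR (stirling1 i r))

  cc-sum≈cc-zero : ∀ i k → sumTo (suc i) (λ r → cc i r k) ≈ cc i 0 (k - 1#)
  cc-sum≈cc-zero i k = begin
    sumTo (suc i) (λ r → cc i r k)    ≈⟨ cc-sum i k ⟩
    falling (1# - k) i
      ≈⟨ falling-cong i (solve 1 (λ k → con (+ 1) :- k := :- (k :- con (+ 1))) refl k) ⟩
    falling (- (k - 1#)) i            ≈⟨ cc-zero i (k - 1#) ⟨
    cc i 0 (k - 1#)                   ∎

  cc-sum-two : ∀ i → sumTo (suc i) (λ r → cc i r (1# + 1#)) ≈ pow (- 1#) i * natR (i !)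
  cc-sum-two i = begin
    sumTo (suc i) (λ r → cc i r (1# + 1#))
      ≈⟨ cc-sum i (1# + 1#) ⟩
    falling (1# - (1# + 1#)) i
      ≈⟨ falling-cong i (solve 0 (con (+ 1) :- (con (+ 1) :+ con (+ 1)) := :- con (+ 1)) refl) ⟩
    falling (- 1#) i                  ≈⟨ falling-neg 1# i ⟩
    pow (- 1#) i * rising 1# i        ≈⟨ *-congˡ (rising-one i) ⟩
    pow (- 1#) i * natR (i !)         ∎

  cc-polynomial-shifted : ∀ i k j → sumTo (suc i) (λ r → cc i r k * pow (j + k) r) ≈ falling j i
  cc-polynomial-shifted i k j = trans (cc-polynomial i k (j + k))
    (falling-cong i (solve 2 (λ j k → j :+ k :- k := j) refl j k))

  cc-polynomial-natR : ∀ i k → sumTo (suc i) (λ r → cc i r k * pow (natR i + k) r) ≈ natR (i !)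
  cc-polynomial-natR i k = trans (cc-polynomial-shifted i k (natR i)) (falling-natR i)

  cc-zero-two : ∀ i → cc i 0 (1# + 1#) ≈ pow (- 1#) i * natR (suc i !)
  cc-zero-two i = trans (cc-zero i (1# + 1#)) (trans (falling-neg (1# + 1#) i) (*-congˡ (rising-two i)))

  module _ (1≉0 : ¬ 1# ≈ 0#) (noZeroDivisors : ∀ x y → x * y ≈ 0# → x ≈ 0# ⊎ y ≈ 0#) where

    falling≈0⇒natR : ∀ i y → falling y i ≈ 0# → ∃[ t ] (t < i × y ≈ natR t)
    falling≈0⇒natR zero    y 1≈0 = ⊥-elim (1≉0 1≈0)
    falling≈0⇒natR (suc i) y fy≈0 with noZeroDivisors (falling y i) (y - natR i) fy≈0
    ... | inj₁ fy≈0′ = map₂ (λ (t<i , y≈t) → ℕ.m<n⇒m<1+n t<i , y≈t) (falling≈0⇒natR i y fy≈0′)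
    ... | inj₂ y-i≈0 = i , ℕ.n<1+n i , x∙y⁻¹≈ε⇒x≈y _ _ y-i≈0

    falling≈0⇔ : ∀ i y → falling y i ≈ 0# ⇔ (∃[ t ] (t < i × y ≈ natR t))
    falling≈0⇔ i y =
      mk⇔ (falling≈0⇒natR i y) (λ (t , t<i , y≈t) → falling≈0-at-natR i y t t<i y≈t)

    cc-polynomial≈0⇔ : ∀ i k m →
      sumTo (suc i) (λ r → cc i r k * pow m r) ≈ 0# ⇔ (∃[ t ] (t < i × m ≈ k + natR t))
    cc-polynomial≈0⇔ i k m = ⇔.trans (≈0-cong (cc-polynomial i k m))
      (⇔.trans (falling≈0⇔ i (m - k)) (∃<-cong (λ t → x-y≈z⇔x≈y+z m k (natR t))))

    cc-sum≈0⇔ : ∀ i k →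
      sumTo (suc i) (λ r → cc i r k) ≈ 0# ⇔ (∃[ t ] (t < i × k ≈ 1# - natR t))
    cc-sum≈0⇔ i k = ⇔.trans (≈0-cong (cc-sum i k))
      (⇔.trans (falling≈0⇔ i (1# - k)) (∃<-cong (λ t → x-y≈z⇔y≈x-z 1# k (natR t))))

corollary2p7 : {c ℓ : Level} (R : CommutativeRing c ℓ)
    → let open CommutativeRing R in let open RingDefs R in
      ¬ (1# ≈ 0#)
    → (∀ x y → x * y ≈ 0# → x ≈ 0# ⊎ y ≈ 0#)
    → (i : ℕ) (j k m : Carrier)
    → (sumRange 0 i (λ r → cc i r k) ≈ cc i 0 (k - 1#))
    × (sumRange 0 i (λ r → cc i r (1# + 1#)) ≈ pow (- 1#) i * natR (i !))
    × (sumRange 0 i (λ r → cc i r k * pow (j + k) r) ≈ falling j i)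
    × (sumRange 0 i (λ r → cc i r k * pow (natR i + k) r) ≈ natR (i !))
    × (0 < i → (sumRange 0 i (λ r → cc i r k * pow m r) ≈ 0#)
                 ⇔ (∃[ t ] (t < i × m ≈ k + natR t)))
    × (0 < i → (sumRange 0 i (λ r → cc i r k) ≈ 0#)
                 ⇔ (∃[ t ] (t < i × k ≈ 1# - natR t)))
    × (cc i 0 (1# + 1#) ≈ pow (- 1#) i * natR (ℕ.suc i !))
corollary2p7 R 1≉0 noZeroDivisors i j k m =
    cc-sum≈cc-zero i k
  , cc-sum-two i
  , cc-polynomial-shifted i k j
  , cc-polynomial-natR i k
  , (λ _ → cc-polynomial≈0⇔ 1≉0 noZeroDivisors i k m)
  , (λ _ → cc-sum≈0⇔ 1≉0 noZeroDivisors i k)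
  , cc-zero-two i
  where open Properties R
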